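{- Let $\mathcal{G}=(\mathcal{V},\mathcal{E})$ be a finite simple undirected graph and let $\mathcal{B}=\{e_1,\dots,e_l\}$ be a batch of new edges, where each $e_i=(u_i,v_i)$ joins two distinct vertices of $\mathcal{V}$ and $e_i\notin\mathcal{E}$. Let $\mathcal{G}'=(\mathcal{V},\mathcal{E}\cup\mathcal{B})$ be the updated graph. For each $i$, let $W_i=N_3(u_i)\cup N_3(v_i)$, where $N_3(x)$ denotes the $3$-hop neighborhood of $x$ in $\mathcal{G}'$, and let $g_i=\mathcal{G}'[W_i]$ be the subgraph of $\mathcal{G}'$ induced by $W_i$. Let $\mathcal{G}_a=g_1\cup\dots\cup g_l$ (union of vertex sets and of edge sets), and let $\mathcal{G}_b=\mathcal{G}_a\setminus\mathcal{B}$ be the graph obtained from $\mathcal{G}_a$ by deleting all edges of $\mathcal{B}$ (keeping the vertex set). Let $\mathcal{C}_a$ and $\mathcal{C}_b$ denote the graphlet frequency vectors of $\mathcal{G}_a$ and $\mathcal{G}_b$. Then $$\mathcal{F}^{\mathcal{G}'}_4=\mathcal{F}^{\mathcal{G}}_4+\mathcal{C}_a-\mathcal{C}_b .$$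
   Context: A graphlet of size $4$ is a connected induced subgraph on $4$ vertices. Up to isomorphism there are six connected graphs on $4$ vertices: the $3$-path, the $3$-star, the $4$-cycle, the tailed triangle (a triangle with a pendant edge), the diamond ($K_4$ minus an edge), and the $4$-clique. For a graph $X$, its graphlet frequency vector $\mathcal{F}^X_4\in\mathbb{Z}_{\ge0}^6$ has, for each of these six types $T$, the number of $4$-element vertex subsets $S$ of $X$ such that the induced subgraph $X[S]$ is isomorphic to $T$. The $k$-hop neighborhood $N_k(x)$ of a vertex $x$ in a graph is the set of vertices at distance at most $k$ from $x$ in that graph. -}

module Defs where

open import Data.Nat using (ℕ; zero; suc)
open import Data.Bool using (Bool; true; false; _∧_; _∨_; not; if_then_else_)
open import Data.Fin using (Fin; zero; suc; _<?_) renaming (_≟_ to _≟F_)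
open import Data.Fin.Properties using ()
open import Data.List using (List; []; _∷_; concatMap; map; length; filterᵇ; allFin)
open import Data.Bool.ListAction using (any; all)
open import Data.Vec using (Vec; []; _∷_; lookup)
open import Data.Product using (_×_; _,_; proj₁; proj₂)
open import Relation.Nullary.Decidable using (⌊_⌋)

_==_ : ∀ {n} → Fin n → Fin n → Bool
x == y = ⌊ x ≟F y ⌋

_<ᵇ_ : ∀ {n} → Fin n → Fin n → Bool
x <ᵇ y = ⌊ x <? y ⌋

_⇔ᵇ_ : Bool → Bool → Bool
true  ⇔ᵇ b = b
false ⇔ᵇ b = not b

record Graph (n : ℕ) : Set where
  field
    vert : Fin n → Bool
    adj  : Fin n → Fin n → Bool
open Graph public

-- The six connected graphs on 4 vertices (graphlet types), on vertex set Fin 4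

data GraphletType : Set where
  path3 star3 cycle4 tailedTriangle diamond clique4 : GraphletType

f0 f1 f2 f3 : Fin 4
f0 = zero
f1 = suc zero
f2 = suc (suc zero)
f3 = suc (suc (suc zero))

typeEdges : GraphletType → List (Fin 4 × Fin 4)
typeEdges path3          = (f0 , f1) ∷ (f1 , f2) ∷ (f2 , f3) ∷ []
typeEdges star3          = (f0 , f1) ∷ (f0 , f2) ∷ (f0 , f3) ∷ []
typeEdges cycle4         = (f0 , f1) ∷ (f1 , f2) ∷ (f2 , f3) ∷ (f3 , f0) ∷ []
typeEdges tailedTriangle = (f0 , f1) ∷ (f1 , f2) ∷ (f2 , f0) ∷ (f2 , f3) ∷ []
typeEdges diamond        = (f0 , f1) ∷ (f0 , f2) ∷ (f0 , f3) ∷ (f1 , f2) ∷ (f1 , f3) ∷ []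
typeEdges clique4        = (f0 , f1) ∷ (f0 , f2) ∷ (f0 , f3) ∷ (f1 , f2) ∷ (f1 , f3) ∷ (f2 , f3) ∷ []

edgeIn : ∀ {n} → List (Fin n × Fin n) → Fin n → Fin n → Bool
edgeIn es x y = any (λ e → ((proj₁ e == x) ∧ (proj₂ e == y)) ∨ ((proj₁ e == y) ∧ (proj₂ e == x))) es

typeAdj : GraphletType → Fin 4 → Fin 4 → Bool
typeAdj T = edgeIn (typeEdges T)

allFin4 : List (Fin 4)
allFin4 = allFin 4

pairs4 : List (Fin 4 × Fin 4)
pairs4 = concatMap (λ i → map (λ j → (i , j)) allFin4) allFin4

injectiveᵇ : Vec (Fin 4) 4 → Bool
injectiveᵇ σ = all (λ p → (proj₁ p == proj₂ p) ∨ not (lookup σ (proj₁ p) == lookup σ (proj₂ p))) pairs4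

perms4 : List (Vec (Fin 4) 4)
perms4 = filterᵇ injectiveᵇ
  (concatMap (λ a → concatMap (λ b → concatMap (λ c → map (λ d → a ∷ b ∷ c ∷ d ∷ [])
     allFin4) allFin4) allFin4) allFin4)

inducedIso : ∀ {n} → Graph n → Vec (Fin n) 4 → GraphletType → Bool
inducedIso X S T = any (λ σ → all (λ p →
    typeAdj T (proj₁ p) (proj₂ p) ⇔ᵇ
    adj X (lookup S (lookup σ (proj₁ p))) (lookup S (lookup σ (proj₂ p)))) pairs4) perms4

-- 4-element subsets of Fin n, listed as strictly increasing quadruples
quads : (n : ℕ) → List (Vec (Fin n) 4)
quads n = concatMap (λ a → concatMap (λ b → concatMap (λ c → map (λ d → a ∷ b ∷ c ∷ d ∷ [])
  (filterᵇ (c <ᵇ_) (allFin n))) (filterᵇ (b <ᵇ_) (allFin n))) (filterᵇ (a <ᵇ_) (allFin n))) (allFin n)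

inVert : ∀ {n} → Graph n → Vec (Fin n) 4 → Bool
inVert X S = all (λ i → vert X (lookup S i)) allFin4

freq : ∀ {n} → Graph n → GraphletType → ℕ
freq {n} X T = length (filterᵇ (λ S → inVert X S ∧ inducedIso X S T) (quads n))

base : ∀ {n} → (Fin n → Fin n → Bool) → Graph n
base E = record { vert = λ _ → true ; adj = E }

updAdj : ∀ {n} → (Fin n → Fin n → Bool) → List (Fin n × Fin n) → Fin n → Fin n → Bool
updAdj E B x y = E x y ∨ edgeIn B x y

updated : ∀ {n} → (Fin n → Fin n → Bool) → List (Fin n × Fin n) → Graph n
updated E B = record { vert = λ _ → true ; adj = updAdj E B }

within : ∀ {n} → (Fin n → Fin n → Bool) → ℕ → Fin n → Fin n → Bool
within A zero    x y = x == y
within {n} A (suc k) x y = within A k x y ∨ any (λ z → within A k x z ∧ A z y) (allFin n)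

W : ∀ {n} → (Fin n → Fin n → Bool) → List (Fin n × Fin n) → Fin n × Fin n → Fin n → Bool
W E B e x = within (updAdj E B) 3 (proj₁ e) x ∨ within (updAdj E B) 3 (proj₂ e) x

Ga : ∀ {n} → (Fin n → Fin n → Bool) → List (Fin n × Fin n) → Graph n
Ga E B = record
  { vert = λ x → any (λ e → W E B e x) B
  ; adj  = λ x y → any (λ e → W E B e x ∧ W E B e y ∧ updAdj E B x y) B }

Gb : ∀ {n} → (Fin n → Fin n → Bool) → List (Fin n × Fin n) → Graph n
Gb E B = record
  { vert = vert (Ga E B)
  ; adj  = λ x y → adj (Ga E B) x y ∧ not (edgeIn B x y) }

-- Sort the 4-sets S by whether some edge of B joins two vertices of S. If none does, G and G'
-- agree on S, and so do G_a and G_b, so S contributes equally to F(G') - F(G) and to C_a - C_b.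
-- If a new edge e = (u, v) joins two vertices of S, then S spans a graphlet in G' (or in G,
-- or in G_a, or in G_b, all subgraphs of G') only if it is connected there; every graphlet has
-- diameter at most 3, so S then lies in N_3(u) ∪ N_3(v) = W_e, on which G_a coincides with G'
-- and G_b with G. Hence S is counted by G' exactly when by G_a, and by G exactly when by G_b.
module Submission where

open import Defs
open import Data.Bool using (Bool; true; false; T; _∧_; _∨_; not)
open import Data.Bool.ListAction using (and; or; any; all)
open import Data.Bool.Properties using (T-∧; T-∨; ∨-identityʳ; ∧-identityʳ; ∧-zeroʳ)
open import Data.Empty using (⊥-elim)
open import Data.Fin using (Fin)
open import Data.Integer using (+_; -_; _+_; _-_)
import Data.Integer.Properties as ℤₚ
open import Data.List using (List; []; _∷_; [_]; length; filterᵇ; allFin)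
open import Data.List.Membership.Propositional using (_∈_; lose; find)
open import Data.List.Membership.Propositional.Properties using (∈-allFin; ∈-cartesianProduct⁺)
open import Data.List.Properties using (map-cong)
open import Data.List.Relation.Unary.All as All using (All)
open import Data.List.Relation.Unary.All.Properties using (all⁺; all⁻)
open import Data.List.Relation.Unary.Any.Properties using (any⁺; any⁻)
open import Data.Nat.Base as ℕ using (ℕ; zero; suc)
import Data.Nat.Properties as ℕₚ
open import Algebra.Properties.CommutativeSemigroup ℕₚ.+-commutativeSemigroup using (interchange)
open import Data.Product using (_×_; _,_; proj₁; proj₂; ∃-syntax; map₂; uncurry)
open import Data.Sum using (_⊎_; inj₁; inj₂; [_,_]′)
import Data.Sum as Sum
open import Data.Vec using (Vec; lookup)
open import Function using (_∘_; Equivalence)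
open import Relation.Nullary using (¬_; Dec; yes; no)
open import Relation.Nullary.Decidable using (toWitness; fromWitness; T?)
open import Relation.Binary.PropositionalEquality
  using (_≡_; _≢_; refl; sym; trans; cong; cong₂; subst; subst₂; module ≡-Reasoning)

∧⁺ : ∀ {a b} → T a × T b → T (a ∧ b)
∧⁺ = Equivalence.from T-∧

∧⁻ : ∀ {a b} → T (a ∧ b) → T a × T b
∧⁻ = Equivalence.to T-∧

∨-introˡ : ∀ {a} b → T a → T (a ∨ b)
∨-introˡ {true} _ _ = _

∨-introʳ : ∀ a {b} → T b → T (a ∨ b)
∨-introʳ true  _  = _
∨-introʳ false tb = tb

∨⁻ : ∀ {a b} → T (a ∨ b) → T a ⊎ T b
∨⁻ = Equivalence.to T-∨

T⇔T⇒≡ : ∀ {a b} → (T a → T b) → (T b → T a) → a ≡ b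
T⇔T⇒≡ {false} {false} _   _   = refl
T⇔T⇒≡ {false} {true}  _   b⇒a = ⊥-elim (b⇒a _)
T⇔T⇒≡ {true}  {false} a⇒b _   = ⊥-elim (a⇒b _)
T⇔T⇒≡ {true}  {true}  _   _   = refl

¬T⇒≡false : ∀ {b} → ¬ T b → b ≡ false
¬T⇒≡false {false} _  = refl
¬T⇒≡false {true}  ¬b = ⊥-elim (¬b _)

⇔ᵇ-elim : ∀ {a b} → T (a ⇔ᵇ b) → T a → T b
⇔ᵇ-elim {true} b _ = b

∨-∧-not-cancel : ∀ a b → (T b → a ≡ false) → (a ∨ b) ∧ not b ≡ a
∨-∧-not-cancel a false _    = trans (∧-identityʳ _) (∨-identityʳ a)
∨-∧-not-cancel a true  b⇒¬a = trans (∧-zeroʳ _) (sym (b⇒¬a _))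

module _ {A : Set} (f : A → Bool) where

  all-∈ : ∀ {xs} → T (all f xs) → ∀ {x} → x ∈ xs → T (f x)
  all-∈ {xs} h = All.lookup (all⁺ f xs h)

  all-intro : ∀ xs → (∀ x → T (f x)) → T (all f xs)
  all-intro xs h = all⁻ f {xs = xs} (All.tabulate (λ {x} _ → h x))

  any-∈ : ∀ {xs x} → x ∈ xs → T (f x) → T (any f xs)
  any-∈ x∈xs fx = any⁺ f (lose x∈xs fx)

  any-witness : ∀ xs → T (any f xs) → ∃[ x ] x ∈ xs × T (f x)
  any-witness xs h = find (any⁻ f xs h)

module _ {A : Set} where

  count : (A → Bool) → List A → ℕ
  count p xs = length (filterᵇ p xs)

  count-∷ : (p : A → Bool) (x : A) (xs : List A)
    → count p (x ∷ xs) ≡ count p [ x ] ℕ.+ count p xs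
  count-∷ p x xs with p x
  ... | true  = refl
  ... | false = refl

  count-singleton-cong : (p q : A → Bool) (x : A) → p x ≡ q x → count p [ x ] ≡ count q [ x ]
  count-singleton-cong p q x p≡q with p x | q x | p≡q
  ... | true  | .true  | refl = refl
  ... | false | .false | refl = refl

  count-balance : (p q r s : A → Bool) (xs : List A)
    → (∀ x → (p x ≡ r x × q x ≡ s x) ⊎ (p x ≡ s x × q x ≡ r x))
    → count p xs ℕ.+ count q xs ≡ count r xs ℕ.+ count s xs
  count-balance p q r s []       _         = refl
  count-balance p q r s (x ∷ xs) pointwise = begin
    count p (x ∷ xs) ℕ.+ count q (x ∷ xs)
      ≡⟨ cong₂ ℕ._+_ (count-∷ p x xs) (count-∷ q x xs) ⟩
    (count p [ x ] ℕ.+ count p xs) ℕ.+ (count q [ x ] ℕ.+ count q xs)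
      ≡⟨ interchange (count p [ x ]) (count p xs) (count q [ x ]) (count q xs) ⟩
    (count p [ x ] ℕ.+ count q [ x ]) ℕ.+ (count p xs ℕ.+ count q xs)
      ≡⟨ cong₂ ℕ._+_ (head (pointwise x)) (count-balance p q r s xs pointwise) ⟩
    (count r [ x ] ℕ.+ count s [ x ]) ℕ.+ (count r xs ℕ.+ count s xs)
      ≡⟨ interchange (count r [ x ]) (count r xs) (count s [ x ]) (count s xs) ⟨
    (count r [ x ] ℕ.+ count r xs) ℕ.+ (count s [ x ] ℕ.+ count s xs)
      ≡⟨ cong₂ ℕ._+_ (count-∷ r x xs) (count-∷ s x xs) ⟨
    count r (x ∷ xs) ℕ.+ count s (x ∷ xs) ∎
    where
    open ≡-Reasoning
    head : (p x ≡ r x × q x ≡ s x) ⊎ (p x ≡ s x × q x ≡ r x)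
         → count p [ x ] ℕ.+ count q [ x ] ≡ count r [ x ] ℕ.+ count s [ x ]
    head (inj₁ (p≡r , q≡s)) =
      cong₂ ℕ._+_ (count-singleton-cong p r x p≡r) (count-singleton-cong q s x q≡s)
    head (inj₂ (p≡s , q≡r)) =
      trans (cong₂ ℕ._+_ (count-singleton-cong p s x p≡s) (count-singleton-cong q r x q≡r))
            (ℕₚ.+-comm (count s [ x ]) (count r [ x ]))

+-difference : ∀ a b c d → a ℕ.+ d ≡ b ℕ.+ c → + a ≡ (+ b + + c) - + d
+-difference a b c d a+d≡b+c = sym (begin
  (+ b + + c) - + d  ≡⟨ cong (_- + d) (ℤₚ.pos-+ b c) ⟨
  + (b ℕ.+ c) - + d  ≡⟨ cong (λ m → + m - + d) a+d≡b+c ⟨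
  + (a ℕ.+ d) - + d  ≡⟨ cong (_- + d) (ℤₚ.pos-+ a d) ⟩
  (+ a + + d) - + d  ≡⟨ ℤₚ.+-assoc (+ a) (+ d) (- + d) ⟩
  + a + (+ d - + d)  ≡⟨ cong (_+_ (+ a)) (ℤₚ.+-inverseʳ (+ d)) ⟩
  + a + + 0          ≡⟨ ℤₚ.+-identityʳ (+ a) ⟩
  + a                ∎)
  where open ≡-Reasoning

Adjacency : ℕ → Set
Adjacency n = Fin n → Fin n → Bool

_⊆ᵃ_ : ∀ {n} → Adjacency n → Adjacency n → Set
R ⊆ᵃ R′ = ∀ {x y} → T (R x y) → T (R′ x y)

data Joins {n} (e : Fin n × Fin n) (x y : Fin n) : Set where
  forward  : proj₁ e ≡ x → proj₂ e ≡ y → Joins e x y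
  backward : proj₁ e ≡ y → proj₂ e ≡ x → Joins e x y

edgeIn-witness : ∀ {n} (es : List (Fin n × Fin n)) {x y}
  → T (edgeIn es x y) → ∃[ e ] e ∈ es × Joins e x y
edgeIn-witness es h with any-witness _ es h
... | e , e∈es , joins =
  e , e∈es , [ uncurry forward , uncurry backward ]′ (Sum.map ==-pair ==-pair (∨⁻ joins))
  where
  ==-pair : ∀ {a b c d} → T ((a == b) ∧ (c == d)) → a ≡ b × c ≡ d
  ==-pair {a} {b} {c} {d} h =
    let a==b , c==d = ∧⁻ {a == b} {c == d} h in toWitness a==b , toWitness c==d

Joins⇒endpoint : ∀ {n} {e : Fin n × Fin n} {x y} → Joins e x y → x ≡ proj₁ e ⊎ x ≡ proj₂ e
Joins⇒endpoint (forward  refl _) = inj₁ refl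
Joins⇒endpoint (backward _ refl) = inj₂ refl

within-map : ∀ {a b} {R : Adjacency a} {R′ : Adjacency b} (h : Fin a → Fin b)
  → (∀ {x y} → T (R x y) → T (R′ (h x) (h y)))
  → ∀ k {x y} → T (within R k x y) → T (within R′ k (h x) (h y))
within-map h hom zero    w = fromWitness (cong h (toWitness w))
within-map h hom (suc k) w with ∨⁻ w
... | inj₁ near = ∨-introˡ _ (within-map h hom k near)
... | inj₂ via with any-witness _ (allFin _) via
...   | z , _ , xz∧zy =
  let xz , zy = ∧⁻ xz∧zy
  in ∨-introʳ _ (any-∈ _ (∈-allFin (h z)) (∧⁺ (within-map h hom k xz , hom zy)))

graphlet-diameter≤3 : ∀ τ p q → T (within (typeAdj τ) 3 p q)
graphlet-diameter≤3 τ p q =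
  all-∈ (within (typeAdj τ) 3 p)
    (all-∈ (λ p → all (within (typeAdj τ) 3 p) allFin4) (check τ) (∈-allFin p)) (∈-allFin q)
  where
  check : ∀ τ → T (all (λ p → all (within (typeAdj τ) 3 p) allFin4) allFin4)
  check path3          = _
  check star3          = _
  check cycle4         = _
  check tailedTriangle = _
  check diamond        = _
  check clique4        = _

surjectiveᵇ : Vec (Fin 4) 4 → Bool
surjectiveᵇ σ = all (λ k → any (λ p → lookup σ p == k) allFin4) allFin4

perms4-surjectiveᵇ : T (all surjectiveᵇ perms4)
perms4-surjectiveᵇ = _

perms4-surjective : ∀ {σ} → σ ∈ perms4 → ∀ k → ∃[ p ] lookup σ p ≡ k
perms4-surjective {σ} σ∈perms4 k =
  let σ-onto = all-∈ surjectiveᵇ perms4-surjectiveᵇ σ∈perms4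
      p , _ , σp==k = any-witness (λ p → lookup σ p == k) allFin4
                        (all-∈ (λ k → any (λ p → lookup σ p == k) allFin4) σ-onto (∈-allFin k))
  in p , toWitness σp==k

pairs4-complete : ∀ p q → (p , q) ∈ pairs4
pairs4-complete p q = ∈-cartesianProduct⁺ (∈-allFin p) (∈-allFin q)

matchesAt : ∀ {n} → Graph n → Vec (Fin n) 4 → GraphletType → Vec (Fin 4) 4
  → Fin 4 × Fin 4 → Bool
matchesAt X S τ σ (p , q) = typeAdj τ p q ⇔ᵇ adj X (lookup S (lookup σ p)) (lookup S (lookup σ q))

inducedIso⇒hom : ∀ {n} (X : Graph n) S τ → T (inducedIso X S τ)
  → ∃[ σ ] σ ∈ perms4
         × (∀ {p q} → T (typeAdj τ p q) → T (adj X (lookup S (lookup σ p)) (lookup S (lookup σ q))))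
inducedIso⇒hom X S τ iso with any-witness (λ σ → all (matchesAt X S τ σ) pairs4) perms4 iso
... | σ , σ∈perms4 , matches =
  σ , σ∈perms4 , λ {p} {q} → ⇔ᵇ-elim (all-∈ (matchesAt X S τ σ) matches (pairs4-complete p q))

inducedIso⇒within3 : ∀ {n} {R : Adjacency n} (X : Graph n) S τ
  → adj X ⊆ᵃ R → T (inducedIso X S τ) → ∀ i j → T (within R 3 (lookup S i) (lookup S j))
inducedIso⇒within3 {R = R} X S τ X⊆R iso i j =
  let σ , σ∈perms4 , hom = inducedIso⇒hom X S τ iso
      p , σp≡i = perms4-surjective σ∈perms4 i
      q , σq≡j = perms4-surjective σ∈perms4 j
  in subst₂ (λ i j → T (within R 3 (lookup S i) (lookup S j))) σp≡i σq≡j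
       (within-map {R = typeAdj τ} {R′ = R} (lookup S ∘ lookup σ) (X⊆R ∘ hom) 3
                   (graphlet-diameter≤3 τ p q))

inducedIso-cong : ∀ {n} (X Y : Graph n) S τ
  → (∀ i j → adj X (lookup S i) (lookup S j) ≡ adj Y (lookup S i) (lookup S j))
  → inducedIso X S τ ≡ inducedIso Y S τ
inducedIso-cong X Y S τ agree =
  cong or (map-cong (λ σ → cong and (map-cong (matches-cong σ) pairs4)) perms4)
  where
  matches-cong : ∀ σ pq → matchesAt X S τ σ pq ≡ matchesAt Y S τ σ pq
  matches-cong σ (p , q) = cong (typeAdj τ p q ⇔ᵇ_) (agree (lookup σ p) (lookup σ q))

occurs : ∀ {n} → GraphletType → Graph n → Vec (Fin n) 4 → Bool
occurs τ X S = inVert X S ∧ inducedIso X S τ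

occurs-local : ∀ {n} {R : Adjacency n} {U : Fin n → Bool} τ (X Y : Graph n) S k
  → adj X ⊆ᵃ R → adj Y ⊆ᵃ R
  → (∀ {y} → T (within R 3 (lookup S k) y) → T (U y))
  → T (inVert X S)
  → ((∀ i → T (U (lookup S i)))
     → T (inVert Y S) × (∀ i j → adj X (lookup S i) (lookup S j) ≡ adj Y (lookup S i) (lookup S j)))
  → occurs τ X S ≡ occurs τ Y S
occurs-local {n} {R} {U} τ X Y S k X⊆R Y⊆R ball⊆U vertX agreeInU = T⇔T⇒≡ X⇒Y Y⇒X
  where
  inside : (Z : Graph n) → adj Z ⊆ᵃ R → T (inducedIso Z S τ) → ∀ i → T (U (lookup S i))
  inside Z Z⊆R iso i = ball⊆U (inducedIso⇒within3 Z S τ Z⊆R iso k i)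

  X⇒Y : T (occurs τ X S) → T (occurs τ Y S)
  X⇒Y occ = let isoX = proj₂ (∧⁻ occ) ; vertY , agree = agreeInU (inside X X⊆R isoX)
            in ∧⁺ (vertY , subst T (inducedIso-cong X Y S τ agree) isoX)

  Y⇒X : T (occurs τ Y S) → T (occurs τ X S)
  Y⇒X occ = let isoY = proj₂ (∧⁻ occ) ; _ , agree = agreeInU (inside Y Y⊆R isoY)
            in ∧⁺ (vertX , subst T (sym (inducedIso-cong X Y S τ agree)) isoY)

module BatchUpdate {n : ℕ} (E : Adjacency n) (E-sym : ∀ x y → E x y ≡ E y x)
  (B : List (Fin n × Fin n))
  (B-new : All (λ e → (proj₁ e ≢ proj₂ e) × (E (proj₁ e) (proj₂ e) ≡ false)) B) where

  G G′ Gᵃ Gᵇ : Graph n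
  G  = base E
  G′ = updated E B
  Gᵃ = Ga E B
  Gᵇ = Gb E B

  B-edge-absent : ∀ {x y} → T (edgeIn B x y) → E x y ≡ false
  B-edge-absent h with edgeIn-witness B h
  ... | e , e∈B , forward  refl refl = proj₂ (All.lookup B-new e∈B)
  ... | e , e∈B , backward refl refl = trans (E-sym _ _) (proj₂ (All.lookup B-new e∈B))

  G⊆G′ : adj G ⊆ᵃ adj G′
  G⊆G′ {x} {y} = ∨-introˡ (edgeIn B x y)

  Gᵃ⊆G′ : adj Gᵃ ⊆ᵃ adj G′
  Gᵃ⊆G′ {x} {y} h with any-witness (λ e → W E B e x ∧ W E B e y ∧ adj G′ x y) B h
  ... | e , _ , inWindow = proj₂ (∧⁻ {W E B e y} (proj₂ (∧⁻ {W E B e x} inWindow)))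

  Gᵇ⊆G′ : adj Gᵇ ⊆ᵃ adj G′
  Gᵇ⊆G′ {x} {y} h = Gᵃ⊆G′ (proj₁ (∧⁻ {adj Gᵃ x y} h))

  ball⊆window : ∀ {e x y} → x ≡ proj₁ e ⊎ x ≡ proj₂ e → T (within (adj G′) 3 x y) → T (W E B e y)
  ball⊆window {e} {y = y} (inj₁ refl) = ∨-introˡ (within (adj G′) 3 (proj₂ e) y)
  ball⊆window {e} {y = y} (inj₂ refl) = ∨-introʳ (within (adj G′) 3 (proj₁ e) y)

  module _ {e} (e∈B : e ∈ B) {x y} (x∈W : T (W E B e x)) (y∈W : T (W E B e y)) where

    Gᵃ-on-window : adj Gᵃ x y ≡ adj G′ x y
    Gᵃ-on-window = T⇔T⇒≡ Gᵃ⊆G′ (λ xy → any-∈ _ e∈B (∧⁺ (x∈W , ∧⁺ (y∈W , xy))))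

    Gᵇ-on-window : adj Gᵇ x y ≡ adj G x y
    Gᵇ-on-window = trans (cong (_∧ not (edgeIn B x y)) Gᵃ-on-window)
                         (∨-∧-not-cancel (E x y) (edgeIn B x y) B-edge-absent)

  newEdgeIn : Vec (Fin n) 4 → Fin 4 → Fin 4 → Bool
  newEdgeIn S i j = edgeIn B (lookup S i) (lookup S j)

  hasNewEdge : Vec (Fin n) 4 → Bool
  hasNewEdge S = any (λ i → any (newEdgeIn S i) allFin4) allFin4

  module _ (τ : GraphletType) where

    occurs-with-new-edge : ∀ S {e i j} → e ∈ B → Joins e (lookup S i) (lookup S j)
      → occurs τ G′ S ≡ occurs τ Gᵃ S × occurs τ G S ≡ occurs τ Gᵇ S
    occurs-with-new-edge S {e} {i} e∈B joins =
        occurs-local {R = adj G′} {U = W E B e} τ G′ Gᵃ S i (λ xy → xy) Gᵃ⊆G′ ball _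
          (λ inW → vertᵃ inW , λ i j → sym (Gᵃ-on-window e∈B (inW i) (inW j)))
      , occurs-local {R = adj G′} {U = W E B e} τ G Gᵇ S i G⊆G′ Gᵇ⊆G′ ball _
          (λ inW → vertᵃ inW , λ i j → sym (Gᵇ-on-window e∈B (inW i) (inW j)))
      where
      ball : ∀ {y} → T (within (adj G′) 3 (lookup S i) y) → T (W E B e y)
      ball = ball⊆window (Joins⇒endpoint joins)

      vertᵃ : (∀ i → T (W E B e (lookup S i))) → T (inVert Gᵃ S)
      vertᵃ inW = all-intro (λ i → vert Gᵃ (lookup S i)) allFin4
                    (λ i → any-∈ (λ e → W E B e (lookup S i)) e∈B (inW i))

    occurs-without-new-edge : ∀ S → (∀ i j → newEdgeIn S i j ≡ false)
      → occurs τ G′ S ≡ occurs τ G S × occurs τ Gᵇ S ≡ occurs τ Gᵃ S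
    occurs-without-new-edge S noB =
        cong (inVert G S ∧_) (inducedIso-cong G′ G S τ λ i j →
          trans (cong (E (lookup S i) (lookup S j) ∨_) (noB i j)) (∨-identityʳ _))
      , cong (inVert Gᵃ S ∧_) (inducedIso-cong Gᵇ Gᵃ S τ λ i j →
          trans (cong (λ b → adj Gᵃ (lookup S i) (lookup S j) ∧ not b) (noB i j)) (∧-identityʳ _))

    occurs-dichotomy : ∀ S
      → (occurs τ G′ S ≡ occurs τ G S × occurs τ Gᵇ S ≡ occurs τ Gᵃ S)
      ⊎ (occurs τ G′ S ≡ occurs τ Gᵃ S × occurs τ Gᵇ S ≡ occurs τ G S)
    occurs-dichotomy S = by-new-edge (T? (hasNewEdge S))
      where
      by-new-edge : Dec (T (hasNewEdge S))
        → (occurs τ G′ S ≡ occurs τ G S × occurs τ Gᵇ S ≡ occurs τ Gᵃ S)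
        ⊎ (occurs τ G′ S ≡ occurs τ Gᵃ S × occurs τ Gᵇ S ≡ occurs τ G S)
      by-new-edge (yes newEdge) =
        let i , _ , crossesᵢ  = any-witness (λ i → any (newEdgeIn S i) allFin4) allFin4 newEdge
            j , _ , crossesᵢⱼ = any-witness (newEdgeIn S i) allFin4 crossesᵢ
            e , e∈B , joins   = edgeIn-witness B crossesᵢⱼ
        in inj₂ (map₂ sym (occurs-with-new-edge S e∈B joins))
      by-new-edge (no ¬newEdge) = inj₁ (occurs-without-new-edge S λ i j → ¬T⇒≡false λ h →
        ¬newEdge (any-∈ (λ i → any (newEdgeIn S i) allFin4) (∈-allFin i)
                        (any-∈ (newEdgeIn S i) (∈-allFin j) h)))

    freq-balance : freq G′ τ ℕ.+ freq Gᵇ τ ≡ freq G τ ℕ.+ freq Gᵃ τ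
    freq-balance = count-balance (occurs τ G′) (occurs τ Gᵇ) (occurs τ G) (occurs τ Gᵃ) (quads n)
                                 occurs-dichotomy

lemma1 : {n : ℕ} (E : Fin n → Fin n → Bool)
         → (∀ x y → E x y ≡ E y x)
         → (∀ x → E x x ≡ false)
         → (B : List (Fin n × Fin n))
         → All (λ e → (proj₁ e ≢ proj₂ e) × (E (proj₁ e) (proj₂ e) ≡ false)) B
         → (T : GraphletType)
         → + freq (updated E B) T ≡ (+ freq (base E) T + + freq (Ga E B) T) - + freq (Gb E B) T
lemma1 E E-sym _ B B-new T =
  +-difference (freq (updated E B) T) (freq (base E) T) (freq (Ga E B) T) (freq (Gb E B) T)
    (BatchUpdate.freq-balance E E-sym B B-new T)
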